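{- The lower distance-hereditary switching class is equal to the lower $\{\text{domino},\text{house},C_5,C_6\}$-free switching class.
   Context: All graphs are finite and simple. For a graph $G$ and $A\subseteq V(G)$, the switching $S(G,A)$ is the graph on $V(G)$ whose edges are the edges of $G$ with both ends in $A$, the edges of $G$ with both ends outside $A$, and all pairs $uv$ with $u\in A$, $v\notin A$, $uv\notin E(G)$. For a graph class $\mathcal{G}$, the lower $\mathcal{G}$ switching class is the class of graphs $G$ such that $S(G,A)\in\mathcal{G}$ for every $A\subseteq V(G)$. A graph $G$ is distance-hereditary if in every connected induced subgraph the distance between any two of its vertices equals their distance in $G$. The house is the complement of the path on five vertices (a 4-cycle plus a vertex adjacent to two adjacent vertices of the cycle); the domino is the $2\times 3$ grid graph (two 4-cycles sharing an edge); $C_5$, $C_6$ are the cycles on 5 and 6 vertices. $\mathcal{H}$-free means no induced subgraph isomorphic to a member of $\mathcal{H}$. -}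

module Defs where

open import Data.Nat using (ℕ; zero; suc)
open import Data.Fin using (Fin; zero; suc; _≟_)
open import Data.Bool using (Bool; true; false; not; _∧_; _∨_; _xor_; if_then_else_)
open import Data.Bool.Properties using (∧-comm; ∨-comm)
open import Data.List using (List; []; _∷_)
open import Data.Product using (_×_; _,_; ∃; Σ)
open import Data.Empty using (⊥)
open import Relation.Nullary using (¬_; does)
open import Relation.Binary.PropositionalEquality using (_≡_; refl; cong; cong₂; sym; trans)
open import Function.Bundles using (_⇔_)
open import Function.Definitions using (Injective)

_==_ : ∀ {n} → Fin n → Fin n → Bool
i == j = does (i ≟ j)

==-sym : ∀ {n} (i j : Fin n) → (i == j) ≡ (j == i)
==-sym zero zero = refl
==-sym zero (suc j) = refl
==-sym (suc i) zero = refl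
==-sym (suc i) (suc j) with i ≟ j | j ≟ i
... | Relation.Nullary.yes _ | Relation.Nullary.yes _ = refl
... | Relation.Nullary.no _ | Relation.Nullary.no _ = refl
... | Relation.Nullary.yes refl | Relation.Nullary.no q = Data.Empty.⊥-elim (q refl)
  where import Data.Empty
... | Relation.Nullary.no p | Relation.Nullary.yes refl = Data.Empty.⊥-elim (p refl)
  where import Data.Empty

==-refl : ∀ {n} (i : Fin n) → (i == i) ≡ true
==-refl zero = refl
==-refl (suc i) with i ≟ i
... | Relation.Nullary.yes _ = refl
... | Relation.Nullary.no p = Data.Empty.⊥-elim (p refl)
  where import Data.Empty

record Graph (n : ℕ) : Set where
  field
    adj    : Fin n → Fin n → Bool
    adj-sym : ∀ u v → adj u v ≡ adj v u
    adj-irr : ∀ u → adj u u ≡ false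
open Graph public

xor-sym : ∀ a b → (a xor b) ≡ (b xor a)
xor-sym false false = refl
xor-sym false true = refl
xor-sym true false = refl
xor-sym true true = refl

xor-self : ∀ a → (a xor a) ≡ false
xor-self false = refl
xor-self true = refl

switchAdj : ∀ {n} → Graph n → (Fin n → Bool) → Fin n → Fin n → Bool
switchAdj G A u v = if (A u xor A v) then not (adj G u v) else adj G u v

switch : ∀ {n} → Graph n → (Fin n → Bool) → Graph n
switch G A = record
  { adj = switchAdj G A
  ; adj-sym = λ u v → cong₂ (λ c e → if c then not e else e) (xor-sym (A u) (A v)) (adj-sym G u v)
  ; adj-irr = λ u → trans (cong (λ c → if c then not (adj G u u) else adj G u u) (xor-self (A u))) (adj-irr G u)
  }

LowerSwitching : (∀ {n} → Graph n → Set) → ∀ {n} → Graph n → Set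
LowerSwitching 𝒢 G = ∀ A → 𝒢 (switch G A)

-- Distances.  Walk G P u v k : a walk with k edges from u to v in G, all of
-- whose vertices satisfy P (i.e. a walk in the induced subgraph G[P]).

data Walk {n} (G : Graph n) (P : Fin n → Bool) : Fin n → Fin n → ℕ → Set where
  here : ∀ {u} → P u ≡ true → Walk G P u u zero
  step : ∀ {u w v k} → P u ≡ true → adj G u w ≡ true → Walk G P w v k → Walk G P u v (suc k)

IsDist : ∀ {n} → Graph n → (Fin n → Bool) → Fin n → Fin n → ℕ → Set
IsDist G P u v d = Walk G P u v d × (∀ k → Walk G P u v k → d Data.Nat.≤ k)
  where import Data.Nat

allV : ∀ {n} → Fin n → Bool
allV _ = true

ConnectedOn : ∀ {n} → Graph n → (Fin n → Bool) → Set
ConnectedOn G P = ∀ u v → P u ≡ true → P v ≡ true → ∃ λ k → Walk G P u v k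

DistanceHereditary : ∀ {n} → Graph n → Set
DistanceHereditary G =
  ∀ (P : Fin _ → Bool) → ConnectedOn G P →
  ∀ u v → P u ≡ true → P v ≡ true →
  ∀ d → IsDist G P u v d ⇔ IsDist G allV u v d

InducedSub : ∀ {k n} → Graph k → Graph n → Set
InducedSub {k} {n} H G =
  Σ (Fin k → Fin n) λ f → Injective _≡_ _≡_ f × (∀ i j → adj H i j ≡ adj G (f i) (f j))

edgeMatch : ∀ {n} → Fin n × Fin n → Fin n → Fin n → Bool
edgeMatch (a , b) i j = ((a == i) ∧ (b == j)) ∨ ((a == j) ∧ (b == i))

anyEdge : ∀ {n} → List (Fin n × Fin n) → Fin n → Fin n → Bool
anyEdge [] i j = false
anyEdge (e ∷ es) i j = edgeMatch e i j ∨ anyEdge es i j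

edgeMatch-sym : ∀ {n} (e : Fin n × Fin n) i j → edgeMatch e i j ≡ edgeMatch e j i
edgeMatch-sym (a , b) i j = ∨-comm ((a == i) ∧ (b == j)) ((a == j) ∧ (b == i))

anyEdge-sym : ∀ {n} (es : List (Fin n × Fin n)) i j → anyEdge es i j ≡ anyEdge es j i
anyEdge-sym [] i j = refl
anyEdge-sym (e ∷ es) i j = cong₂ _∨_ (edgeMatch-sym e i j) (anyEdge-sym es i j)

fromEdges : ∀ {n} → List (Fin n × Fin n) → Graph n
fromEdges es = record
  { adj = λ i j → not (i == j) ∧ anyEdge es i j
  ; adj-sym = λ i j → cong₂ (λ x y → not x ∧ y) (==-sym i j) (anyEdge-sym es i j)
  ; adj-irr = λ i → cong (λ x → not x ∧ anyEdge es i i) (==-refl i)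
  }

private
  v0 v1 v2 v3 v4 : ∀ {n} → Fin (5 Data.Nat.+ n)
  v0 = zero
  v1 = suc zero
  v2 = suc (suc zero)
  v3 = suc (suc (suc zero))
  v4 = suc (suc (suc (suc zero)))
  v5 : Fin 6
  v5 = suc (suc (suc (suc (suc zero))))
  import Data.Nat

C5 : Graph 5
C5 = fromEdges ((v0 , v1) ∷ (v1 , v2) ∷ (v2 , v3) ∷ (v3 , v4) ∷ (v4 , v0) ∷ [])

C6 : Graph 6
C6 = fromEdges ((v0 , v1) ∷ (v1 , v2) ∷ (v2 , v3) ∷ (v3 , v4) ∷ (v4 , v5) ∷ (v5 , v0) ∷ [])

-- house: 4-cycle 0-1-2-3-0 plus vertex 4 adjacent to 0 and 1
house : Graph 5
house = fromEdges ((v0 , v1) ∷ (v1 , v2) ∷ (v2 , v3) ∷ (v3 , v0) ∷ (v4 , v0) ∷ (v4 , v1) ∷ [])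

-- domino: 2×3 grid, rows 0-1-2 and 3-4-5, columns 0-3, 1-4, 2-5
domino : Graph 6
domino = fromEdges ((v0 , v1) ∷ (v1 , v2) ∷ (v3 , v4) ∷ (v4 , v5) ∷ (v0 , v3) ∷ (v1 , v4) ∷ (v2 , v5) ∷ [])

DHC5C6Free : ∀ {n} → Graph n → Set
DHC5C6Free G = ¬ InducedSub domino G × ¬ InducedSub house G × ¬ InducedSub C5 G × ¬ InducedSub C6 G

{-# OPTIONS --safe #-}

-- Switching commutes with taking induced subgraphs: an induced copy of H in S(G, A), switched
-- by B, is an induced copy of S(H, B) in another switching S(G, A′).  The domino, the house, C5
-- and C6 each have two vertices a, b at distance 2 whose only common neighbour c can be deleted
-- without disconnecting the graph, so no distance-hereditary graph contains them.  Conversely,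
-- the gem and P4 + K1 both switch to C5, so if no switching of G contains the domino, the house,
-- C5 or C6, then every switching avoids all six graphs.  In such a graph a shortest path inside a
-- connected induced subgraph is an induced path of length at most 4 (P6 contains P4 + K1), and a
-- strictly shorter path of the whole graph between its ends closes up with it into one of the six.

module Submission where

open import Defs
open import Algebra using (CommutativeRing)
open import Data.Bool using (Bool; true; false; not; _∨_; _xor_)
import Data.Bool as Bool
open import Data.Bool.Properties using (∨-comm; xor-assoc; xor-comm; xor-∧-commutativeRing; ¬-not)
open import Data.Empty using (⊥; ⊥-elim)
open import Data.Fin using (Fin; zero; suc; toℕ; _≟_; #_)
open import Data.Fin.Properties using (all?; any?; toℕ<n)
open import Data.List using (List; []; _∷_; _++_; map; tabulate)
open import Data.List.Relation.Unary.All using (All; []; _∷_)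
import Data.List.Relation.Unary.All as All
open import Data.List.Relation.Unary.All.Properties
  using (++⁺; ++⁻ˡ; ++⁻ʳ; map⁺; map⁻; tabulate⁺; tabulate⁻)
open import Data.Nat using (ℕ; zero; suc; _+_; _∸_; _≤_; _<_; _≡ᵇ_; z≤n; s≤s; s≤s⁻¹)
open import Data.Nat.Properties
  using (+-suc; +-identityʳ; <⇒≱; ≤∧≢⇒<; ≤-trans; ≤-antisym; ≮⇒≥; ∸-monoʳ-<; +-cancelˡ-≤; +-cancelʳ-≤)
open import Data.Product using (_×_; _,_; ∃; Σ; proj₁; proj₂; uncurry)
import Data.Product as Product
open import Data.Vec using (Vec; []; _∷_; lookup)
open import Function using (id; _∘_)
open import Function.Bundles using (_⇔_; mk⇔; Equivalence)
open import Function.Definitions using (Injective)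
open import Relation.Nullary using (¬_; Dec; yes; no; does)
open import Relation.Nullary.Decidable
  using (True; _×-dec_; _→-dec_; ¬?; map′; from-yes; toWitness; dec-true; dec-false)
open import Relation.Binary.PropositionalEquality
  using (_≡_; _≢_; refl; sym; trans; cong; cong₂; subst; module ≡-Reasoning)

open import Algebra.Properties.CommutativeSemigroup
  (CommutativeRing.+-commutativeSemigroup xor-∧-commutativeRing) using (interchange)

from-does : ∀ {a} {A : Set a} (a? : Dec A) → does a? ≡ true → A
from-does (yes a) _ = a

adj-sym′ : ∀ {n} (G : Graph n) {u v b} → adj G u v ≡ b → adj G v u ≡ b
adj-sym′ G {u} {v} uv = trans (adj-sym G v u) uv

false≢true : false ≢ true
false≢true ()

adj⇒≢ : ∀ {n} (G : Graph n) {u v} → adj G u v ≡ true → u ≢ v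
adj⇒≢ G {u} uv refl = false≢true (trans (sym (adj-irr G u)) uv)

preimage? : ∀ {k n} (f : Fin k → Fin n) (S : Fin k → Bool) (u : Fin n) →
            Dec (∃ λ i → S i ≡ true × f i ≡ u)
preimage? f S u = any? λ i → (S i Bool.≟ true) ×-dec (f i ≟ u)

image : ∀ {k n} → (Fin k → Fin n) → (Fin k → Bool) → Fin n → Bool
image f S u = does (preimage? f S u)

module _ {k n} {f : Fin k → Fin n} {S : Fin k → Bool} where

  image-preimage : ∀ {u} → image f S u ≡ true → ∃ λ i → S i ≡ true × f i ≡ u
  image-preimage {u} = from-does (preimage? f S u)

  image-∘ : Injective _≡_ _≡_ f → ∀ i → image f S (f i) ≡ S i
  image-∘ inj i with S i in Si
  ... | true  = dec-true (preimage? f S (f i)) (i , Si , refl)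
  ... | false = dec-false (preimage? f S (f i)) λ where
    (j , Sj , fj≡fi) → false≢true (trans (sym Si) (trans (cong S (inj (sym fj≡fi))) Sj))

WalksAtLeast : ∀ {n} → Graph n → (Fin n → Bool) → Fin n → Fin n → ℕ → Set
WalksAtLeast G P u v m = ∀ k → Walk G P u v k → m ≤ k

mapʷ : ∀ {k n} {H : Graph k} {G : Graph n} {Q P} (f : Fin k → Fin n) →
       (∀ {i} → Q i ≡ true → P (f i) ≡ true) →
       (∀ {i j} → adj H i j ≡ true → adj G (f i) (f j) ≡ true) →
       ∀ {i j l} → Walk H Q i j l → Walk G P (f i) (f j) l
mapʷ f inP hom (here q)     = here (inP q)
mapʷ f inP hom (step q e W) = step (inP q) (hom e) (mapʷ f inP hom W)

module _ {n} {G : Graph n} {P : Fin n → Bool} where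

  source-in : ∀ {u v k} → Walk G P u v k → P u ≡ true
  source-in (here p)     = p
  source-in (step p _ _) = p

  target-in : ∀ {u v k} → Walk G P u v k → P v ≡ true
  target-in (here p)     = p
  target-in (step _ _ W) = target-in W

  _++ʷ_ : ∀ {u w v a b} → Walk G P u w a → Walk G P w v b → Walk G P u v (a + b)
  here _     ++ʷ W′ = W′
  step p e W ++ʷ W′ = step p e (W ++ʷ W′)

  reverseʷ : ∀ {u v k} → Walk G P u v k → ∃ λ l → Walk G P v u l
  reverseʷ (here p)     = _ , here p
  reverseʷ (step p e W) =
    _ , proj₂ (reverseʷ W) ++ʷ step (source-in W) (adj-sym′ G e) (here p)

  unrestrict : ∀ {u v k} → Walk G P u v k → Walk G allV u v k
  unrestrict = mapʷ id (λ _ → refl) id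

  walk? : ∀ k u v → Dec (Walk G P u v k)
  walk? zero u v =
    map′ (λ { (pu , refl) → here pu }) (λ { (here pu) → pu , refl })
         ((P u Bool.≟ true) ×-dec (u ≟ v))
  walk? (suc k) u v =
    map′ (λ { (_ , pu , e , W) → step pu e W }) (λ { (step pu e W) → _ , pu , e , W })
         (any? λ w → (P u Bool.≟ true) ×-dec (adj G u w Bool.≟ true) ×-dec walk? k w v)

  shortest : ∀ {u v k} → Walk G P u v k → ∃ (IsDist G P u v)
  shortest {u} {v} {k} W = search 0 k (λ _ _ → z≤n) (subst (Walk G P u v) (sym (+-identityʳ k)) W)
    where
    search : ∀ j d → WalksAtLeast G P u v j → Walk G P u v (d + j) → ∃ (IsDist G P u v)
    search j d atLeast W with walk? j u v
    ... | yes Wj = j , Wj , atLeast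
    search j zero    atLeast W | no ¬Wj = ⊥-elim (¬Wj W)
    search j (suc d) atLeast W | no ¬Wj =
      search (suc j) d atLeast′ (subst (Walk G P u v) (sym (+-suc d j)) W)
      where
      atLeast′ : WalksAtLeast G P u v (suc j)
      atLeast′ l Wl = ≤∧≢⇒< (atLeast l Wl) λ { refl → ¬Wj Wl }

  prefix-atLeast : ∀ {u w v a c} → Walk G P w v c →
                   WalksAtLeast G P u v (a + c) → WalksAtLeast G P u w a
  prefix-atLeast {a = a} {c} R atLeast k W = +-cancelʳ-≤ c a k (atLeast (k + c) (W ++ʷ R))

  suffix-atLeast : ∀ {u w v a c} → Walk G P u w a →
                   WalksAtLeast G P u v (a + c) → WalksAtLeast G P w v c
  suffix-atLeast {a = a} {c} R atLeast k W = +-cancelˡ-≤ a c k (atLeast (a + k) (R ++ʷ W))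

  mutual
    vertices : ∀ {u v m} → Walk G P u v m → Vec (Fin n) (suc m)
    vertices {u} W = u ∷ afterSource W

    afterSource : ∀ {u v m} → Walk G P u v m → Vec (Fin n) m
    afterSource (here _)     = []
    afterSource (step _ _ W) = vertices W

  suffix : ∀ {u v m} (W : Walk G P u v m) (i : Fin (suc m)) →
           Walk G P (lookup (vertices W) i) v (m ∸ toℕ i)
  suffix W            zero    = W
  suffix (step _ _ W) (suc i) = suffix W i

TwinFree : ∀ {k} → Graph k → Set
TwinFree {k} H = ∀ (i j : Fin k) → i ≢ j → ∃ λ x → adj H i x ≢ adj H j x

twinFree? : ∀ {k} (H : Graph k) → Dec (TwinFree H)
twinFree? H = all? λ i → all? λ j → ¬? (i ≟ j) →-dec any? λ x → ¬? (adj H i x Bool.≟ adj H j x)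

Free : ∀ {k} → Graph k → ∀ {n} → Graph n → Set
Free F G = ¬ InducedSub F G

pairs : ∀ k → List (Fin k × Fin k)
pairs zero    = []
pairs (suc k) = tabulate (λ j → zero , suc j) ++ map (Product.map suc suc) (pairs k)

all-pairs : ∀ {k} {R : Fin k → Fin k → Set} → (∀ i → R i i) → (∀ {i j} → R i j → R j i) →
            All (uncurry R) (pairs k) → ∀ i j → R i j
all-pairs {suc k} diag sym rs zero    zero    = diag zero
all-pairs {suc k} diag sym rs zero    (suc j) = tabulate⁻ (++⁻ˡ _ rs) j
all-pairs {suc k} diag sym rs (suc i) zero    = sym (tabulate⁻ (++⁻ˡ _ rs) i)
all-pairs {suc k} {R} diag sym rs (suc i) (suc j) =
  all-pairs {R = λ i j → R (suc i) (suc j)} (diag ∘ suc) sym (map⁻ (++⁻ʳ _ rs)) i j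

-- One fact per pair i < j, in lexicographic order.
Induces : ∀ {k n} → Graph n → Graph k → Vec (Fin n) k → Set
Induces {k} G H xs = All (uncurry λ i j → adj G (lookup xs i) (lookup xs j) ≡ adj H i j) (pairs k)

induces? : ∀ {k n} (G : Graph n) (H : Graph k) (xs : Vec (Fin n) k) → Dec (Induces G H xs)
induces? G H xs = All.all? (λ _ → _ Bool.≟ _) (pairs _)

module _ {k n} {H : Graph k} {G : Graph n} where

  induces-adj : ∀ {xs} → Induces G H xs → ∀ i j → adj G (lookup xs i) (lookup xs j) ≡ adj H i j
  induces-adj {xs} = all-pairs {R = λ i j → adj G (lookup xs i) (lookup xs j) ≡ adj H i j}
                               (λ i → trans (adj-irr G _) (sym (adj-irr H i)))
                               (λ {i} {j} eq → trans (adj-sym G _ _) (trans eq (adj-sym H i j)))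

  embedding : TwinFree H → (f : Fin k → Fin n) → (∀ i j → adj H i j ≡ adj G (f i) (f j)) →
              InducedSub H G
  embedding twinFree f eqs = f , injective , eqs
    where
    injective : Injective _≡_ _≡_ f
    injective {i} {j} fi≡fj with i ≟ j
    ... | yes i≡j = i≡j
    ... | no  i≢j =
      let x , differ = twinFree i j i≢j
      in ⊥-elim (differ (trans (eqs i x) (trans (cong (λ y → adj G y (f x)) fi≡fj) (sym (eqs j x)))))

-- Twin-freeness of H makes lookup xs injective, so the entries of xs need not be known distinct.
induced : ∀ {k n} (H : Graph k) {twinFree : True (twinFree? H)} (G : Graph n) (xs : Vec (Fin n) k) →
          Induces G H xs → InducedSub H G
induced H {twinFree} G xs ind =
  embedding {H = H} {G} (toWitness twinFree) (lookup xs) λ i j →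
    sym (induces-adj {H = H} {G} {xs} ind i j)

induced-trans : ∀ {j k n} {F : Graph j} {H : Graph k} {G : Graph n} →
                InducedSub F H → InducedSub H G → InducedSub F G
induced-trans (f , f-inj , f-adj) (g , g-inj , g-adj) =
  g ∘ f , f-inj ∘ g-inj , λ i j → trans (f-adj i j) (g-adj (f i) (f j))

induced-≗ : ∀ {k n} {H : Graph k} {G G′ : Graph n} →
            (∀ u v → adj G u v ≡ adj G′ u v) → InducedSub H G → InducedSub H G′
induced-≗ same (f , inj , eqs) = f , inj , λ i j → trans (eqs i j) (same (f i) (f j))

switch-xor : ∀ {n} (G : Graph n) A u v → adj (switch G A) u v ≡ (A u xor A v) xor adj G u v
switch-xor G A u v with A u xor A v
... | true  = refl
... | false = refl

_△_ : ∀ {n} → (Fin n → Bool) → (Fin n → Bool) → Fin n → Bool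
(A △ B) w = A w xor B w

switch-switch : ∀ {n} (G : Graph n) A B u v → adj (switch (switch G A) B) u v ≡ adj (switch G (A △ B)) u v
switch-switch G A B u v = begin
  adj (switch (switch G A) B) u v          ≡⟨ switch-xor (switch G A) B u v ⟩
  (B u xor B v) xor adj (switch G A) u v   ≡⟨ cong ((B u xor B v) xor_) (switch-xor G A u v) ⟩
  (B u xor B v) xor ((A u xor A v) xor e)  ≡⟨ xor-assoc (B u xor B v) (A u xor A v) e ⟨
  ((B u xor B v) xor (A u xor A v)) xor e  ≡⟨ cong (_xor e) (xor-comm (B u xor B v) (A u xor A v)) ⟩
  ((A u xor A v) xor (B u xor B v)) xor e  ≡⟨ cong (_xor e) (interchange (A u) (A v) (B u) (B v)) ⟩
  ((A u xor B u) xor (A v xor B v)) xor e  ≡⟨ switch-xor G (A △ B) u v ⟨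
  adj (switch G (A △ B)) u v               ∎
  where
  open ≡-Reasoning
  e : Bool
  e = adj G u v

switch-induced : ∀ {k n} {H : Graph k} {G : Graph n} (I : InducedSub H G) (B : Fin k → Bool) →
                 InducedSub (switch H B) (switch G (image (proj₁ I) B))
switch-induced {H = H} {G} (f , inj , eqs) B = f , inj , λ i j → begin
  adj (switch H B) i j                           ≡⟨ switch-xor H B i j ⟩
  (B i xor B j) xor adj H i j                    ≡⟨ cong₂ _xor_ (cong₂ _xor_ (B′∘f i) (B′∘f j)) (eqs i j) ⟩
  (B′ (f i) xor B′ (f j)) xor adj G (f i) (f j)  ≡⟨ switch-xor G B′ (f i) (f j) ⟨
  adj (switch G B′) (f i) (f j)                  ∎
  where
  open ≡-Reasoning
  B′ : Fin _ → Bool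
  B′ = image f B
  B′∘f : ∀ i → B i ≡ B′ (f i)
  B′∘f i = sym (image-∘ inj i)

switching-induced : ∀ {k n} {H : Graph k} {G : Graph n} {A} →
                    InducedSub H (switch G A) → ∀ B → ∃ λ A′ → InducedSub (switch H B) (switch G A′)
switching-induced {H = H} {G} {A} I B =
  A △ B′ , induced-≗ {H = switch H B} {switch (switch G A) B′} {switch G (A △ B′)}
                     (switch-switch G A B′) (switch-induced {H = H} {switch G A} I B)
  where
  B′ : Fin _ → Bool
  B′ = image (proj₁ I) B

lowerFree-switch : ∀ {j k n} {F : Graph j} {H : Graph k} {G : Graph n} →
                   (∃ λ B → InducedSub F (switch H B)) → LowerSwitching (Free F) G → LowerSwitching (Free H) G
lowerFree-switch {F = F} {H} {G} (B , F⊑H) free A I =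
  let A′ , I′ = switching-induced {H = H} {G} {A} I B
  in  free A′ (induced-trans {F = F} {switch H B} {switch G A′} F⊑H I′)

-- Four graphs that are not distance hereditary

reachesWithin? : ∀ {k} (H : Graph k) (Q : Fin k → Bool) (r : Fin k) →
                 Dec (∀ i → Q i ≡ true → Σ (Fin k) λ l → Walk H Q i r (toℕ l))
reachesWithin? H Q r = all? λ i → (Q i Bool.≟ true) →-dec any? λ l → walk? (toℕ l) i r

rooted-connected : ∀ {k} {H : Graph k} {Q} (r : Fin k) →
                   (∀ i → Q i ≡ true → ∃ λ l → Walk H Q i r l) → ConnectedOn H Q
rooted-connected r reach i j qi qj =
  let _ , W = reach i qi ; _ , W′ = reverseʷ (proj₂ (reach j qj)) in _ , W ++ʷ W′

commonNeighboursOnly? : ∀ {k} (H : Graph k) (a b c : Fin k) →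
                        Dec (∀ i → adj H a i ≡ true → adj H i b ≡ true → i ≡ c)
commonNeighboursOnly? H a b c =
  all? λ i → (adj H a i Bool.≟ true) →-dec (adj H i b Bool.≟ true) →-dec (i ≟ c)

distance-two : ∀ {n} {G : Graph n} {u w v} → u ≢ v → adj G u v ≡ false →
               adj G u w ≡ true → adj G w v ≡ true → IsDist G allV u v 2
distance-two {G = G} u≢v u≁v uw wv = step refl uw (step refl wv (here refl)) , atLeast
  where
  atLeast : WalksAtLeast G allV _ _ 2
  atLeast zero          (here _)             = ⊥-elim (u≢v refl)
  atLeast (suc zero)    (step _ uv (here _)) = ⊥-elim (false≢true (trans (sym u≁v) uv))
  atLeast (suc (suc _)) _                    = s≤s (s≤s z≤n)

avoid : ∀ {k} → Fin k → Fin k → Bool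
avoid c i = not (i == c)

avoid-self : ∀ {k} (c : Fin k) → avoid c c ≡ false
avoid-self c = cong not (==-refl c)

avoid-other : ∀ {k} {c i : Fin k} → i ≢ c → avoid c i ≡ true
avoid-other {c = c} {i} i≢c = cong not (dec-false (i ≟ c) i≢c)

-- Deleting c keeps H connected but pushes a and b, at distance 2, further apart.
record Detour {k} (H : Graph k) (a c b : Fin k) : Set where
  field
    a≢b       : a ≢ b
    a~c       : adj H a c ≡ true
    c~b       : adj H c b ≡ true
    a≁b       : adj H a b ≡ false
    only-c    : ∀ i → adj H a i ≡ true → adj H i b ≡ true → i ≡ c
    reaches-a : ∀ i → avoid c i ≡ true → Σ (Fin k) λ l → Walk H (avoid c) i a (toℕ l)

detour-forbidden : ∀ {k n} {H : Graph k} {G : Graph n} {a c b} →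
                   Detour H a c b → DistanceHereditary G → ¬ InducedSub H G
detour-forbidden {H = H} {G} {a} {c} {b} D dh (f , inj , eqs) = no-2-walk-in-P (proj₁ distance-in-P)
  where
  open Detour D
  P : Fin _ → Bool
  P = image f (avoid c)
  in-P : ∀ {i} → avoid c i ≡ true → P (f i) ≡ true
  in-P {i} q = trans (image-∘ inj i) q
  hom : ∀ {i j} → adj H i j ≡ true → adj G (f i) (f j) ≡ true
  hom {i} {j} e = trans (sym (eqs i j)) e
  H-c-connected : ConnectedOn H (avoid c)
  H-c-connected = rooted-connected a λ i q → Product.map toℕ id (reaches-a i q)
  P-connected : ConnectedOn G P
  P-connected u v Pu Pv with image-preimage {f = f} {avoid c} Pu | image-preimage {f = f} {avoid c} Pv
  ... | i , qi , refl | j , qj , refl = Product.map id (mapʷ f in-P hom) (H-c-connected i j qi qj)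
  distance-in-P : IsDist G P (f a) (f b) 2
  distance-in-P =
    Equivalence.from (dh P P-connected (f a) (f b) (in-P (avoid-other (adj⇒≢ H a~c)))
                                                     (in-P (avoid-other (adj⇒≢ H c~b ∘ sym))) 2)
                     (distance-two (a≢b ∘ inj) (trans (sym (eqs a b)) a≁b) (hom a~c) (hom c~b))
  no-2-walk-in-P : ¬ Walk G P (f a) (f b) 2
  no-2-walk-in-P (step _ fa~w (step Pw w~fb (here _))) with image-preimage {f = f} {avoid c} Pw
  ... | i , avoids-i , refl =
    false≢true (trans (sym (avoid-self c)) (subst (λ j → avoid c j ≡ true) i≡c avoids-i))
    where
    i≡c : i ≡ c
    i≡c = only-c i (trans (eqs a i) fa~w) (trans (eqs i b) w~fb)

C5-detour : Detour C5 (# 1) (# 0) (# 4)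
C5-detour = record
  { a≢b = λ () ; a~c = refl ; c~b = refl ; a≁b = refl
  ; only-c    = from-yes (commonNeighboursOnly? C5 (# 1) (# 4) (# 0))
  ; reaches-a = from-yes (reachesWithin? C5 (avoid (# 0)) (# 1))
  }

C6-detour : Detour C6 (# 0) (# 1) (# 2)
C6-detour = record
  { a≢b = λ () ; a~c = refl ; c~b = refl ; a≁b = refl
  ; only-c    = from-yes (commonNeighboursOnly? C6 (# 0) (# 2) (# 1))
  ; reaches-a = from-yes (reachesWithin? C6 (avoid (# 1)) (# 0))
  }

house-detour : Detour house (# 4) (# 0) (# 3)
house-detour = record
  { a≢b = λ () ; a~c = refl ; c~b = refl ; a≁b = refl
  ; only-c    = from-yes (commonNeighboursOnly? house (# 4) (# 3) (# 0))
  ; reaches-a = from-yes (reachesWithin? house (avoid (# 0)) (# 4))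
  }

domino-detour : Detour domino (# 0) (# 1) (# 2)
domino-detour = record
  { a≢b = λ () ; a~c = refl ; c~b = refl ; a≁b = refl
  ; only-c    = from-yes (commonNeighboursOnly? domino (# 0) (# 2) (# 1))
  ; reaches-a = from-yes (reachesWithin? domino (avoid (# 1)) (# 0))
  }

distanceHereditary⇒free : ∀ {n} {G : Graph n} → DistanceHereditary G → DHC5C6Free G
distanceHereditary⇒free dh =
  detour-forbidden domino-detour dh , detour-forbidden house-detour dh ,
  detour-forbidden C5-detour dh , detour-forbidden C6-detour dh

-- Shortest walks are induced paths

path : ∀ k → Graph k
path k = record
  { adj     = λ i j → consecutive (toℕ i) (toℕ j)
  ; adj-sym = λ i j → ∨-comm (suc (toℕ i) ≡ᵇ toℕ j) (suc (toℕ j) ≡ᵇ toℕ i)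
  ; adj-irr = λ i → cong₂ _∨_ (suc≢ᵇ (toℕ i)) (suc≢ᵇ (toℕ i))
  }
  where
  consecutive : ℕ → ℕ → Bool
  consecutive m n = (suc m ≡ᵇ n) ∨ (suc n ≡ᵇ m)
  suc≢ᵇ : ∀ m → (suc m ≡ᵇ m) ≡ false
  suc≢ᵇ zero    = refl
  suc≢ᵇ (suc m) = suc≢ᵇ m

module _ {n} {G : Graph n} {P : Fin n → Bool} where

  shortest-induces-path : ∀ {u v m} (R : Walk G P u v m) → WalksAtLeast G P u v m →
                          Induces G (path (suc m)) (vertices R)
  shortest-induces-path (here _) _ = []
  shortest-induces-path {u} {v} {suc m} (step pu e R) atLeast =
    ++⁺ (tabulate⁺ {f = λ j → zero , suc j} from-u)
        (map⁺ {f = Product.map suc suc} (shortest-induces-path R R-atLeast))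
    where
    R-atLeast : WalksAtLeast G P _ v m
    R-atLeast = suffix-atLeast (step pu e (here (source-in R))) atLeast
    from-u : ∀ j → adj G u (lookup (vertices R) j) ≡ adj (path (suc (suc m))) zero (suc j)
    from-u zero    = e
    from-u (suc j) = ¬-not {y = true} λ chord →
      <⇒≱ (∸-monoʳ-< (s≤s z≤n) (toℕ<n j)) (s≤s⁻¹ (atLeast _ (step pu chord (suffix R (suc j)))))

  restricted-distance : ∀ {u v m} → Walk G P u v m → WalksAtLeast G allV u v m →
                        ∀ d → IsDist G P u v d ⇔ IsDist G allV u v d
  restricted-distance {u} {v} {m} R atLeast d = mk⇔ to from
    where
    to : IsDist G P u v d → IsDist G allV u v d
    to (W , minimal) = unrestrict W , λ k Wk → ≤-trans (minimal m R) (atLeast k Wk)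
    from : IsDist G allV u v d → IsDist G P u v d
    from (W , minimal) = subst (Walk G P u v) (≤-antisym (atLeast d W) (minimal m (unrestrict R))) R ,
                         λ k Wk → minimal k (unrestrict Wk)

-- Graphs all of whose switchings avoid the six forbidden graphs

gem : Graph 5
gem = fromEdges ((# 0 , # 1) ∷ (# 1 , # 2) ∷ (# 2 , # 3) ∷
                 (# 4 , # 0) ∷ (# 4 , # 1) ∷ (# 4 , # 2) ∷ (# 4 , # 3) ∷ [])

P4+K1 : Graph 5
P4+K1 = fromEdges ((# 0 , # 1) ∷ (# 1 , # 2) ∷ (# 2 , # 3) ∷ [])

C5-in-switched-gem : ∃ λ B → InducedSub C5 (switch gem B)
C5-in-switched-gem =
  B , induced C5 (switch gem B) xs (from-yes (induces? (switch gem B) C5 xs))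
  where
  B : Fin 5 → Bool
  B = lookup (false ∷ true ∷ true ∷ false ∷ false ∷ [])
  xs : Vec (Fin 5) 5
  xs = # 0 ∷ # 2 ∷ # 1 ∷ # 3 ∷ # 4 ∷ []

C5-in-switched-P4+K1 : ∃ λ B → InducedSub C5 (switch P4+K1 B)
C5-in-switched-P4+K1 =
  B , induced C5 (switch P4+K1 B) xs (from-yes (induces? (switch P4+K1 B) C5 xs))
  where
  B : Fin 5 → Bool
  B = lookup (true ∷ false ∷ false ∷ true ∷ false ∷ [])
  xs : Vec (Fin 5) 5
  xs = # 0 ∷ # 2 ∷ # 1 ∷ # 3 ∷ # 4 ∷ []

module _ {n} (G : Graph n) (free : DHC5C6Free G) (no-gem : Free gem G) (no-P4+K1 : Free P4+K1 G) where

  private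
    no-domino : Free domino G
    no-domino = proj₁ free
    no-house : Free house G
    no-house = proj₁ (proj₂ free)
    no-C5 : Free C5 G
    no-C5 = proj₁ (proj₂ (proj₂ free))
    no-C6 : Free C6 G
    no-C6 = proj₂ (proj₂ (proj₂ free))
    flip : ∀ {u v b} → adj G u v ≡ b → adj G v u ≡ b
    flip = adj-sym′ G

  P4-ends-no-common-neighbour : ∀ {a b c d w} → Induces G (path 4) (a ∷ b ∷ c ∷ d ∷ []) →
                                adj G w a ≡ true → adj G w d ≡ true → ⊥
  P4-ends-no-common-neighbour {a} {b} {c} {d} {w} (ab ∷ ac ∷ ad ∷ bc ∷ bd ∷ cd ∷ []) wa wd
    with adj G w b in wb | adj G w c in wc
  ... | false | false = no-C5 (induced C5 G (a ∷ b ∷ c ∷ d ∷ w ∷ [])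
          (ab ∷ ac ∷ ad ∷ flip wa ∷ bc ∷ bd ∷ flip wb ∷ cd ∷ flip wc ∷ flip wd ∷ []))
  ... | true  | false = no-house (induced house G (w ∷ b ∷ c ∷ d ∷ a ∷ [])
          (wb ∷ wc ∷ wd ∷ wa ∷ bc ∷ bd ∷ flip ab ∷ cd ∷ flip ac ∷ flip ad ∷ []))
  ... | false | true  = no-house (induced house G (c ∷ w ∷ a ∷ b ∷ d ∷ [])
          (flip wc ∷ flip ac ∷ flip bc ∷ cd ∷ wa ∷ wb ∷ wd ∷ ab ∷ ad ∷ bd ∷ []))
  ... | true  | true  = no-gem (induced gem G (a ∷ b ∷ c ∷ d ∷ w ∷ [])
          (ab ∷ ac ∷ ad ∷ flip wa ∷ bc ∷ bd ∷ flip wb ∷ cd ∷ flip wc ∷ flip wd ∷ []))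

  P5-ends-no-common-neighbour : ∀ {r₀ r₁ r₂ r₃ r₄ w} →
                                Induces G (path 5) (r₀ ∷ r₁ ∷ r₂ ∷ r₃ ∷ r₄ ∷ []) →
                                adj G w r₀ ≡ true → adj G w r₄ ≡ true → ⊥
  P5-ends-no-common-neighbour {r₀} {r₁} {r₂} {r₃} {r₄} {w}
    (p01 ∷ p02 ∷ p03 ∷ p04 ∷ p12 ∷ p13 ∷ p14 ∷ p23 ∷ p24 ∷ p34 ∷ []) w0 w4
    with adj G w r₁ in w1 | adj G w r₃ in w3 | adj G w r₂ in w2
  ... | true  | _     | _     = P4-ends-no-common-neighbour (p12 ∷ p13 ∷ p14 ∷ p23 ∷ p24 ∷ p34 ∷ []) w1 w4
  ... | false | true  | _     = P4-ends-no-common-neighbour (p01 ∷ p02 ∷ p03 ∷ p12 ∷ p13 ∷ p23 ∷ []) w0 w3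
  ... | false | false | true  = no-domino (induced domino G (r₁ ∷ r₂ ∷ r₃ ∷ r₀ ∷ w ∷ r₄ ∷ [])
          (p12 ∷ p13 ∷ flip p01 ∷ flip w1 ∷ p14 ∷ p23 ∷ flip p02 ∷ flip w2 ∷ p24 ∷ flip p03 ∷ flip w3 ∷ p34 ∷
           flip w0 ∷ p04 ∷ w4 ∷ []))
  ... | false | false | false = no-C6 (induced C6 G (r₀ ∷ r₁ ∷ r₂ ∷ r₃ ∷ r₄ ∷ w ∷ [])
          (p01 ∷ p02 ∷ p03 ∷ p04 ∷ flip w0 ∷ p12 ∷ p13 ∷ p14 ∷ flip w1 ∷ p23 ∷ p24 ∷ flip w2 ∷ p34 ∷
           flip w3 ∷ flip w4 ∷ []))

  P5-ends-no-3-walk : ∀ {r₀ r₁ r₂ r₃ r₄ x y} → Induces G (path 5) (r₀ ∷ r₁ ∷ r₂ ∷ r₃ ∷ r₄ ∷ []) →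
                      adj G x r₀ ≡ true → adj G x y ≡ true → adj G y r₄ ≡ true → ⊥
  P5-ends-no-3-walk {r₀} {r₁} {r₂} {r₃} {r₄} {x} {y}
    P5@(p01 ∷ p02 ∷ p03 ∷ p04 ∷ p12 ∷ p13 ∷ p14 ∷ p23 ∷ p24 ∷ p34 ∷ []) x0 xy y4
    with adj G x r₄ in x4
  ... | true = P5-ends-no-common-neighbour P5 x0 x4
  ... | false with adj G y r₀ in y0
  ... | true = P5-ends-no-common-neighbour P5 y0 y4
  ... | false with adj G x r₃ in x3
  ... | true = P4-ends-no-common-neighbour (p01 ∷ p02 ∷ p03 ∷ p12 ∷ p13 ∷ p23 ∷ []) x0 x3
  ... | false with adj G y r₁ in y1
  ... | true = P4-ends-no-common-neighbour (p12 ∷ p13 ∷ p14 ∷ p23 ∷ p24 ∷ p34 ∷ []) y1 y4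
  ... | false with adj G x r₂ in x2
  ... | true = P4-ends-no-common-neighbour (x2 ∷ x3 ∷ x4 ∷ p23 ∷ p24 ∷ p34 ∷ []) (flip xy) y4
  ... | false with adj G y r₂ in y2
  ... | true = P4-ends-no-common-neighbour (p01 ∷ p02 ∷ flip y0 ∷ p12 ∷ flip y1 ∷ flip y2 ∷ []) x0 xy
  ... | false with adj G x r₁ in x1
  ... | false = no-P4+K1 (induced P4+K1 G (x ∷ r₀ ∷ r₁ ∷ r₂ ∷ r₄ ∷ [])
          (x0 ∷ x1 ∷ x2 ∷ x4 ∷ p01 ∷ p02 ∷ p04 ∷ p12 ∷ p14 ∷ p24 ∷ []))
  ... | true with adj G y r₃ in y3
  ... | false = no-P4+K1 (induced P4+K1 G (r₂ ∷ r₃ ∷ r₄ ∷ y ∷ r₀ ∷ [])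
          (p23 ∷ p24 ∷ flip y2 ∷ flip p02 ∷ p34 ∷ flip y3 ∷ flip p03 ∷ flip y4 ∷ flip p04 ∷ y0 ∷ []))
  ... | true = no-C5 (induced C5 G (x ∷ r₁ ∷ r₂ ∷ r₃ ∷ y ∷ [])
          (x1 ∷ x2 ∷ x3 ∷ xy ∷ p12 ∷ p13 ∷ flip y1 ∷ p23 ∷ flip y2 ∷ flip y3 ∷ []))

  no-induced-P6 : ∀ {r₀ r₁ r₂ r₃ r₄ r₅} → ¬ Induces G (path 6) (r₀ ∷ r₁ ∷ r₂ ∷ r₃ ∷ r₄ ∷ r₅ ∷ [])
  no-induced-P6 {r₀} {r₁} {r₂} {r₃} {r₄} {r₅}
    (p01 ∷ p02 ∷ p03 ∷ _ ∷ p05 ∷ p12 ∷ p13 ∷ _ ∷ p15 ∷ p23 ∷ _ ∷ p25 ∷ _ ∷ p35 ∷ _ ∷ []) =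
    no-P4+K1 (induced P4+K1 G (r₀ ∷ r₁ ∷ r₂ ∷ r₃ ∷ r₅ ∷ [])
      (p01 ∷ p02 ∷ p03 ∷ p05 ∷ p12 ∷ p13 ∷ p15 ∷ p23 ∷ p25 ∷ p35 ∷ []))

  shortest-length<5 : ∀ {P u v m} (R : Walk G P u v (5 + m)) → ¬ WalksAtLeast G P u v (5 + m)
  shortest-length<5 (step p₀ e₀ (step p₁ e₁ (step p₂ e₂ (step p₃ e₃ (step p₄ e₄ R))))) atLeast =
    no-induced-P6 (shortest-induces-path R₅ (prefix-atLeast R atLeast))
    where
    R₅ : Walk G _ _ _ 5
    R₅ = step p₀ e₀ (step p₁ e₁ (step p₂ e₂ (step p₃ e₃ (step p₄ e₄ (here (source-in R))))))

  no-detour : ∀ {P u x y v m k} (R : Walk G P u v m) → WalksAtLeast G P u v m →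
              adj G u x ≡ true → adj G x y ≡ true → Walk G allV y v k → 2 + k < m → ⊥
  no-detour R@(step _ _ (step _ _ (step _ _ (here _)))) atLeast ux xy (here _) _ =
    P4-ends-no-common-neighbour (shortest-induces-path R atLeast) (flip ux) xy
  no-detour R@(step _ _ (step _ _ (step _ _ (step _ _ (here _))))) atLeast ux xy (here _) _ =
    P5-ends-no-common-neighbour (shortest-induces-path R atLeast) (flip ux) xy
  no-detour R@(step _ _ (step _ _ (step _ _ (step _ _ (here _))))) atLeast ux xy (step _ yv (here _)) _ =
    P5-ends-no-3-walk (shortest-induces-path R atLeast) (flip ux) xy yv
  no-detour R@(step _ _ (step _ _ (step _ _ (step _ _ (step _ _ _))))) atLeast _ _ _ _ =
    shortest-length<5 R atLeast
  no-detour (here _) _ _ _ _ ()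
  no-detour (step _ _ (here _)) _ _ _ _ (s≤s ())
  no-detour (step _ _ (step _ _ (here _))) _ _ _ _ (s≤s (s≤s ()))
  no-detour (step _ _ (step _ _ (step _ _ (here _)))) _ _ _ (step _ _ _) (s≤s (s≤s (s≤s ())))
  no-detour (step _ _ (step _ _ (step _ _ (step _ _ (here _))))) _ _ _ (step _ _ (step _ _ _))
            (s≤s (s≤s (s≤s (s≤s ()))))

  no-shortcut : ∀ {P u v m k} (R : Walk G P u v m) → WalksAtLeast G P u v m →
                Walk G allV u v k → k < m → ⊥
  no-shortcut R atLeast (here _) k<m =
    <⇒≱ k<m (atLeast 0 (here (source-in R)))
  no-shortcut R atLeast (step _ uv (here _)) k<m =
    <⇒≱ k<m (atLeast 1 (step (source-in R) uv (here (target-in R))))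
  no-shortcut R atLeast (step _ ux (step _ xy W)) k<m =
    no-detour R atLeast ux xy W k<m

  free⇒distanceHereditary : DistanceHereditary G
  free⇒distanceHereditary P connected u v Pu Pv with shortest (proj₂ (connected u v Pu Pv))
  ... | m , R , atLeast = restricted-distance R λ k W → ≮⇒≥ (no-shortcut R atLeast W)

mainTheorem19 : ∀ (n : ℕ) (G : Graph n) →
    LowerSwitching DistanceHereditary G ⇔ LowerSwitching DHC5C6Free G
mainTheorem19 n G = mk⇔ (λ dh A → distanceHereditary⇒free (dh A)) free⇒dh
  where
  free⇒dh : LowerSwitching DHC5C6Free G → LowerSwitching DistanceHereditary G
  free⇒dh free A = free⇒distanceHereditary (switch G A) (free A) (no-gem A) (no-P4+K1 A)
    where
    no-C5 : LowerSwitching (Free C5) G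
    no-C5 A′ = proj₁ (proj₂ (proj₂ (free A′)))
    no-gem : LowerSwitching (Free gem) G
    no-gem = lowerFree-switch {F = C5} {gem} {G} C5-in-switched-gem no-C5
    no-P4+K1 : LowerSwitching (Free P4+K1) G
    no-P4+K1 = lowerFree-switch {F = C5} {P4+K1} {G} C5-in-switched-P4+K1 no-C5
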